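{- Let $\mathcal C$ be a set of frame conditions, $x$ a variable and $t$ a term. The substitution rule $\dfrac{\mathcal G}{\mathcal G(t/x)}$ is height-preserving admissible in $\mathsf{N}\mathsf{Q}^{\circ}_{=}.\mathsf{K}(\mathcal{C})$: if $\mathcal G$ has a proof of height $h$, then $\mathcal G(t/x)$ has a proof of height at most $h$.
   Context: $\mathcal G(t/x)$ denotes the nested sequent obtained from $\mathcal G$ by replacing every (free) occurrence of the variable $x$ by $t$, both in signatures and in formulas, renaming bound variables where needed to avoid capture. The height of a proof is the length of a maximal branch. Syntax. Terms are variables or constants. Formulas (negation normal form): $\phi ::= P(\vec t)\mid \neg P(\vec t)\mid t=s\mid t\neq s\mid \phi\lor\phi\mid\phi\land\phi\mid\exists x\phi\mid\forall x\phi\mid\Diamond\phi\mid\Box\phi$ ($P$ an $n$-ary predicate, $n\ge 0$). A literal is $P(\vec t)$, $\neg P(\vec t)$, $t=s$ or $t\neq s$; a negative literal is $\neg P(\vec t)$ or $t\neq s$. The negation $\overline{\phi}$ swaps $P(\vec t)/\neg P(\vec t)$, $=/\neq$, $\lor/\land$, $\exists/\forall$, $\Diamond/\Box$ (De Morgan duals). $\phi(t/x)$ is capture-avoiding substitution for free occurrences; formulas differing only in bound variable names are identified. Frames. A frame is $\langle W,R,U,D\rangle$ with $W\neq\emptyset$, $R\subseteq W\times W$, $U\neq\emptyset$ and $D_w\subseteq U$ for each $w\in W$. Frame conditions: $\mathbf D$: every $w$ has some $u$ with $wRu$; $\mathbf G(n,k)$ ($n,k\in\mathbb N$): $wR^nu$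 and $wR^kv$ imply $uRv$ ($R^0$ = identity); $\mathbf{ID}$: $wRv\Rightarrow D_w\subseteq D_v$; $\mathbf{DD}$: $wRv\Rightarrow D_v\subseteq D_w$; $\mathbf{CD}$: $D_w=U$ for all $w$; $\mathbf{NE}$: $D_w\neq\emptyset$ for all $w$. $\mathcal C$ is a set of such conditions, assumed closed: if one of these conditions holds on every frame satisfying all of $\mathcal C$, it belongs to $\mathcal C$. $\mathbf G$ denotes the set of all $\mathbf G(n,k)\in\mathcal C$. Grammars. Characters $\mathsf f$, $\mathsf b$. A $\Sigma$-system $S$ is a set of productions $c\to s$, $c\in\{\mathsf f,\mathsf b\}$, $s$ a string over $\{\mathsf f,\mathsf b\}$; $s'cr'\to s'sr'$ is a one-step derivation, $\to^*_S$ its reflexive-transitive closure, $L_S(s)=\{t: s\to^*_S t\}$. $S(\mathbf G)$ contains $\mathsf f\to\mathsf b^n\mathsf f^k$ and $\mathsf b\to\mathsf b^k\mathsf f^n$ for each $\mathbf G(n,k)\in\mathbf G$; $S4=\{\mathsf f\to\varepsilon,\mathsf b\to\varepsilon,\mathsf f\to\mathsf f\mathsf f,\mathsf b\to\mathsf b\mathsf b\}$; $S5=\{\mathsf f\to\varepsilon,\mathsf b\to\varepsilon,\mathsf f\to\mathsf b\mathsf f,\mathsf b\to\mathsf b\mathsf f\}$. Nested sequents. A flat sequent is $\vec t,\vec\phi$: a finite multiset $\vec t$ of terms (signature) and a finite multiset $\vec\phi$ of formulas. A nested sequent is $\Gamma,[\mathcal H_1],\dots,[\mathcal H_n]$ ($n\ge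 0$) with $\Gamma$ flat and $\mathcal H_i$ nested sequents; it is a tree of flat sequents (components), each with a unique name, $\Gamma$ being the root and the roots of the $\mathcal H_i$ its children. A context $\mathcal G\{\}$ has a hole in a component; $\mathcal G\{\mathcal H\}$ fills it, $\mathcal G\{\emptyset\}$ removes it; $\mathcal G\{\cdot\}_{w}\{\cdot\}_{u}$ indicates holes in the components named $w,u$. Propagation: for each parent $w$ and child $u$ we have $w\xrightarrow{\mathsf f}u$ and $u\xrightarrow{\mathsf b}w$; $w\xrightarrow{c_1\cdots c_m}u$ means there are components $w=v_0,\dots,v_m=u$ with $v_{i-1}\xrightarrow{c_i}v_i$ ($w=u$ for the empty string); $w\xrightarrow{L}u$ means $w\xrightarrow{s}u$ for some $s\in L$. Calculus. Rules (premises $\Rightarrow$ conclusion): (ax) $\Rightarrow\mathcal G\{L,\overline L\}$, $L$ a literal; ($\lor$) $\mathcal G\{\phi,\psi\}\Rightarrow\mathcal G\{\phi\lor\psi\}$; ($\land$) $\mathcal G\{\phi\}$, $\mathcal G\{\psi\}\Rightarrow\mathcal G\{\phi\land\psi\}$; ($\exists$) $\mathcal G\{t,\exists x\psi,\psi(t/x)\}\Rightarrow\mathcal G\{t,\exists x\psi\}$; ($\forall$) $\mathcal G\{y,\phi(y/x)\}\Rightarrow\mathcal G\{\forall x\phi\}$, $y$ a variable not free in the conclusion; ($\Diamond$) $\mathcal G\{\Diamond\phi\}_w\{\phi\}_u\Rightarrow\mathcal G\{\Diamond\phi\}_w\{\emptyset\}_u$ provided $w\xrightarrow{L}u$, $L=L_{S(\mathbf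 G)}(\mathsf f)$; ($\Box$) $\mathcal G\{[\phi]\}\Rightarrow\mathcal G\{\Box\phi\}$; (ref) $\mathcal G\{t\neq t\}\Rightarrow\mathcal G\{\emptyset\}$; (rep) $\mathcal G\{t\neq s,N(t/z),N(s/z)\}\Rightarrow\mathcal G\{t\neq s,N(t/z)\}$, $N$ a negative literal; (drep) $\mathcal G\{s,t,t\neq s\}\Rightarrow\mathcal G\{t,t\neq s\}$; (rig) $\mathcal G\{s\neq t\}_w\{s\neq t\}_u\Rightarrow\mathcal G\{s\neq t\}_w\{\emptyset\}_u$, $w\neq u$; (dp) $\mathcal G\{t\}_w\{t\}_u\Rightarrow\mathcal G\{t\}_w\{\emptyset\}_u$, $w\neq u$, $w\xrightarrow{L}u$ with $L=L_{S4\cup S(\mathbf G)}(\mathsf f)$ if $\mathbf{ID}\in\mathcal C,\mathbf{DD}\notin\mathcal C$, $L=L_{S4\cup S(\mathbf G)}(\mathsf b)$ if $\mathbf{DD}\in\mathcal C,\mathbf{ID}\notin\mathcal C$, $L=L_{S5}(\mathsf f)$ if both; (d) $\mathcal G\{[\emptyset]\}\Rightarrow\mathcal G\{\emptyset\}$; (nd) $\mathcal G\{y\}\Rightarrow\mathcal G\{\emptyset\}$, $y$ a variable not free in the conclusion; (cd) $\mathcal G\{t\}\Rightarrow\mathcal G\{\emptyset\}$. $\mathsf N\mathsf Q^\circ_=.\mathsf K(\mathcal C)$ consists of ax, $\lor$, $\land$, $\exists$, $\forall$, $\Diamond$, $\Box$, ref, rep, drep, rig, plus dp iff $\mathcal C\cap\{\mathbf{ID},\mathbf{DD}\}\neq\emptyset$,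 nd iff $\mathbf{NE}\in\mathcal C$, cd iff $\mathbf{CD}\in\mathcal C$, d iff $\mathbf D\in\mathcal C$. A proof is a finite tree of nested sequents whose nodes are conclusions of rule instances with their children as premises and whose leaves are ax instances. -}

module Defs where

open import Data.Nat using (ℕ; zero; suc; _⊔_)
open import Data.List using (List; []; _∷_; _++_; replicate)
open import Data.List.Relation.Unary.Any using (_─_)
open import Data.List.Membership.Propositional using (_∈_)
open import Data.Vec using (Vec)
import Data.Vec.Relation.Unary.Any
import Data.Vec as Vec
open import Data.Maybe using (Maybe; just; nothing)
open import Data.Product using (Σ; _×_; _,_; ∃)
open import Data.Sum using (_⊎_)
open import Data.Empty using (⊥)
open import Data.Unit using (⊤)
open import Relation.Nullary using (¬_; Dec; yes; no)
open import Relation.Binary.PropositionalEquality using (_≡_; _≢_)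
open import Relation.Binary.Construct.Closure.ReflexiveTransitive using (Star)
import Data.Nat as Nat

-- Syntax (locally nameless: free variables are named, bound variables
-- are de Bruijn indices, so alpha-equivalent formulas are identical)

Var : Set
Var = ℕ

Const : Set
Const = ℕ

data Term : Set where
  var : Var → Term
  con : Const → Term

data Tm : Set where
  fv : Var → Tm
  cn : Const → Tm
  bv : ℕ → Tm

⌜_⌝ : Term → Tm
⌜ var x ⌝ = fv x
⌜ con c ⌝ = cn c

record PredSym : Set where
  constructor psym
  field
    name  : ℕ
    arity : ℕ
open PredSym public

-- formulas in negation normal form; ex / all bind bound index 0
data Fm : Set where
  pos  : (P : PredSym) → Vec Tm (arity P) → Fm
  neg  : (P : PredSym) → Vec Tm (arity P) → Fm
  eq   : Tm → Tm → Fm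
  neq  : Tm → Tm → Fm
  _∨_  : Fm → Fm → Fm
  _∧_  : Fm → Fm → Fm
  ex   : Fm → Fm
  all  : Fm → Fm
  dia  : Fm → Fm
  box  : Fm → Fm

data Literal : Fm → Set where
  lpos : ∀ P ts → Literal (pos P ts)
  lneg : ∀ P ts → Literal (neg P ts)
  leq  : ∀ t s → Literal (eq t s)
  lneq : ∀ t s → Literal (neq t s)

data Negative : Fm → Set where
  nneg : ∀ P ts → Negative (neg P ts)
  nneq : ∀ t s → Negative (neq t s)

dual : Fm → Fm
dual (pos P ts) = neg P ts
dual (neg P ts) = pos P ts
dual (eq t s)   = neq t s
dual (neq t s)  = eq t s
dual (φ ∨ ψ)    = dual φ ∧ dual ψ
dual (φ ∧ ψ)    = dual φ ∨ dual ψ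
dual (ex φ)     = all (dual φ)
dual (all φ)    = ex (dual φ)
dual (dia φ)    = box (dual φ)
dual (box φ)    = dia (dual φ)

openTm : ℕ → Term → Tm → Tm
openTm k t (fv x) = fv x
openTm k t (cn c) = cn c
openTm k t (bv i) with k Nat.≟ i
... | yes _ = ⌜ t ⌝
... | no  _ = bv i

openAt : ℕ → Term → Fm → Fm
openAt k t (pos P ts) = pos P (Vec.map (openTm k t) ts)
openAt k t (neg P ts) = neg P (Vec.map (openTm k t) ts)
openAt k t (eq a b)   = eq (openTm k t a) (openTm k t b)
openAt k t (neq a b)  = neq (openTm k t a) (openTm k t b)
openAt k t (φ ∨ ψ)    = openAt k t φ ∨ openAt k t ψ
openAt k t (φ ∧ ψ)    = openAt k t φ ∧ openAt k t ψ
openAt k t (ex φ)     = ex (openAt (suc k) t φ)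
openAt k t (all φ)    = all (openAt (suc k) t φ)
openAt k t (dia φ)    = dia (openAt k t φ)
openAt k t (box φ)    = box (openAt k t φ)

inst : Fm → Term → Fm
inst φ t = openAt 0 t φ

substTerm : Var → Term → Term → Term
substTerm x t (var y) with x Nat.≟ y
... | yes _ = t
... | no  _ = var y
substTerm x t (con c) = con c

substTm : Var → Term → Tm → Tm
substTm x t (fv y) with x Nat.≟ y
... | yes _ = ⌜ t ⌝
... | no  _ = fv y
substTm x t (cn c) = cn c
substTm x t (bv i) = bv i

substFm : Var → Term → Fm → Fm
substFm x t (pos P ts) = pos P (Vec.map (substTm x t) ts)
substFm x t (neg P ts) = neg P (Vec.map (substTm x t) ts)
substFm x t (eq a b)   = eq (substTm x t a) (substTm x t b)
substFm x t (neq a b)  = neq (substTm x t a) (substTm x t b)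
substFm x t (φ ∨ ψ)    = substFm x t φ ∨ substFm x t ψ
substFm x t (φ ∧ ψ)    = substFm x t φ ∧ substFm x t ψ
substFm x t (ex φ)     = ex (substFm x t φ)
substFm x t (all φ)    = all (substFm x t φ)
substFm x t (dia φ)    = dia (substFm x t φ)
substFm x t (box φ)    = box (substFm x t φ)

data OccTm (y : Var) : Tm → Set where
  here : OccTm y (fv y)

data OccFm (y : Var) : Fm → Set where
  opos : ∀ {P ts} → Data.Vec.Relation.Unary.Any.Any (OccTm y) ts → OccFm y (pos P ts)
  oneg : ∀ {P ts} → Data.Vec.Relation.Unary.Any.Any (OccTm y) ts → OccFm y (neg P ts)
  oeq₁ : ∀ {a b} → OccTm y a → OccFm y (eq a b)
  oeq₂ : ∀ {a b} → OccTm y b → OccFm y (eq a b)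
  oneq₁ : ∀ {a b} → OccTm y a → OccFm y (neq a b)
  oneq₂ : ∀ {a b} → OccTm y b → OccFm y (neq a b)
  oor₁ : ∀ {φ ψ} → OccFm y φ → OccFm y (φ ∨ ψ)
  oor₂ : ∀ {φ ψ} → OccFm y ψ → OccFm y (φ ∨ ψ)
  oand₁ : ∀ {φ ψ} → OccFm y φ → OccFm y (φ ∧ ψ)
  oand₂ : ∀ {φ ψ} → OccFm y ψ → OccFm y (φ ∧ ψ)
  oex  : ∀ {φ} → OccFm y φ → OccFm y (ex φ)
  oall : ∀ {φ} → OccFm y φ → OccFm y (all φ)
  odia : ∀ {φ} → OccFm y φ → OccFm y (dia φ)
  obox : ∀ {φ} → OccFm y φ → OccFm y (box φ)

-- Multisets are
-- represented by lists; every rule locates its principal items by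
-- membership, so rule applicability does not depend on the order.

data NSeq : Set where
  node : (sig : List Term) → (fms : List Fm) → (ch : List NSeq) → NSeq

-- component names: addresses (paths of child indices from the root)
Addr : Set
Addr = List ℕ

mutual
  get : NSeq → Addr → Maybe NSeq
  get G [] = just G
  get (node σ Δ ch) (i ∷ p) = getCh ch i p

  getCh : List NSeq → ℕ → Addr → Maybe NSeq
  getCh [] i p = nothing
  getCh (H ∷ hs) zero p = get H p
  getCh (H ∷ hs) (suc i) p = getCh hs i p

-- replace the component at an address (the subtree's children kept
-- only through the new node given)
mutual
  set : NSeq → Addr → NSeq → NSeq
  set G [] K = K
  set (node σ Δ ch) (i ∷ p) K = node σ Δ (setCh ch i p K)

  setCh : List NSeq → ℕ → Addr → NSeq → List NSeq
  setCh [] i p K = []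
  setCh (H ∷ hs) zero p K = set H p K ∷ hs
  setCh (H ∷ hs) (suc i) p K = H ∷ setCh hs i p K

mutual
  substNS : Var → Term → NSeq → NSeq
  substNS x t (node σ Δ ch) =
    node (Data.List.map (substTerm x t) σ) (Data.List.map (substFm x t) Δ) (substNSs x t ch)

  substNSs : Var → Term → List NSeq → List NSeq
  substNSs x t [] = []
  substNSs x t (H ∷ hs) = substNS x t H ∷ substNSs x t hs

data OccNS (y : Var) : NSeq → Set where
  osig : ∀ {σ Δ ch} → var y ∈ σ → OccNS y (node σ Δ ch)
  ofm  : ∀ {σ Δ ch φ} → φ ∈ Δ → OccFm y φ → OccNS y (node σ Δ ch)
  och  : ∀ {σ Δ ch H} → H ∈ ch → OccNS y H → OccNS y (node σ Δ ch)

record Frame : Set₁ where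
  field
    W   : Set
    R   : W → W → Set
    U   : Set
    Dom : W → U → Set      -- D_w ⊆ U, as a predicate on U
    w₀  : W                -- W ≠ ∅
    u₀  : U                -- U ≠ ∅

data FC : Set where
  cD cID cDD cCD cNE : FC
  cG : ℕ → ℕ → FC

Rpow : (F : Frame) → ℕ → Frame.W F → Frame.W F → Set
Rpow F zero w u = w ≡ u
Rpow F (suc n) w u = Σ (Frame.W F) λ v → Frame.R F w v × Rpow F n v u

Holds : FC → Frame → Set
Holds cD  F = ∀ w → Σ (Frame.W F) λ u → Frame.R F w u
Holds cID F = ∀ w v → Frame.R F w v → ∀ a → Frame.Dom F w a → Frame.Dom F v a
Holds cDD F = ∀ w v → Frame.R F w v → ∀ a → Frame.Dom F v a → Frame.Dom F w a
Holds cCD F = ∀ w a → Frame.Dom F w a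
Holds cNE F = ∀ w → Σ (Frame.U F) λ a → Frame.Dom F w a
Holds (cG n k) F = ∀ w u v → Rpow F n w u → Rpow F k w v → Frame.R F u v

CondSet : Set₁
CondSet = FC → Set

Closed : CondSet → Set₁
Closed C = ∀ c → (∀ (F : Frame) → (∀ c' → C c' → Holds c' F) → Holds c F) → C c

data Ch : Set where
  f b : Ch

Str : Set
Str = List Ch

-- a Σ-system: a set of productions c → s
System : Set₁
System = Ch → Str → Set

data SysG (C : CondSet) : System where
  gf : ∀ {n k} → C (cG n k) → SysG C f (replicate n b ++ replicate k f)
  gb : ∀ {n k} → C (cG n k) → SysG C b (replicate k b ++ replicate n f)

data S4 : System where
  s4f  : S4 f []
  s4b  : S4 b []
  s4ff : S4 f (f ∷ f ∷ [])
  s4bb : S4 b (b ∷ b ∷ [])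

data S5 : System where
  s5f  : S5 f []
  s5b  : S5 b []
  s5fb : S5 f (b ∷ f ∷ [])
  s5bb : S5 b (b ∷ f ∷ [])

_∪S_ : System → System → System
(S ∪S S') c s = S c s ⊎ S' c s

data Step (S : System) : Str → Str → Set where
  step : ∀ l c r s → S c s → Step S (l ++ c ∷ r) (l ++ s ++ r)

Lang : System → Str → Str → Set
Lang S s t = Star (Step S) s t

Valid : NSeq → Addr → Set
Valid G w = Σ NSeq λ H → get G w ≡ just H

Edge : NSeq → Ch → Addr → Addr → Set
Edge G f w u = Σ ℕ λ i → (u ≡ w ++ i ∷ []) × Valid G u
Edge G b w u = Edge G f u w

Path : NSeq → Str → Addr → Addr → Set
Path G [] w u = w ≡ u
Path G (c ∷ s) w u = Σ Addr λ v → Edge G c w v × Path G s v u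

Reach : NSeq → (Str → Set) → Addr → Addr → Set
Reach G L w u = Σ Str λ s → L s × Path G s w u

LDia : CondSet → Str → Set
LDia C = Lang (SysG C) (f ∷ [])

DPCond : CondSet → NSeq → Addr → Addr → Set
DPCond C G w u =
    (C cID × ¬ C cDD × Reach G (Lang (S4 ∪S SysG C) (f ∷ [])) w u)
  ⊎ (C cDD × ¬ C cID × Reach G (Lang (S4 ∪S SysG C) (b ∷ [])) w u)
  ⊎ (C cID × C cDD × Reach G (Lang S5 (f ∷ [])) w u)

data Der (C : CondSet) : NSeq → Set where
  ax   : ∀ {G w σ Δ ch L} → get G w ≡ just (node σ Δ ch) →
         Literal L → L ∈ Δ → dual L ∈ Δ → Der C G
  or   : ∀ {G w σ Δ ch φ ψ} → get G w ≡ just (node σ Δ ch) →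
         (i : (φ ∨ ψ) ∈ Δ) →
         Der C (set G w (node σ (φ ∷ ψ ∷ (Δ ─ i)) ch)) → Der C G
  and  : ∀ {G w σ Δ ch φ ψ} → get G w ≡ just (node σ Δ ch) →
         (i : (φ ∧ ψ) ∈ Δ) →
         Der C (set G w (node σ (φ ∷ (Δ ─ i)) ch)) →
         Der C (set G w (node σ (ψ ∷ (Δ ─ i)) ch)) → Der C G
  exR  : ∀ {G w σ Δ ch ψ t} → get G w ≡ just (node σ Δ ch) →
         t ∈ σ → ex ψ ∈ Δ →
         Der C (set G w (node σ (inst ψ t ∷ Δ) ch)) → Der C G
  allR : ∀ {G w σ Δ ch φ} (y : Var) → get G w ≡ just (node σ Δ ch) →
         (i : all φ ∈ Δ) → ¬ OccNS y G →
         Der C (set G w (node (var y ∷ σ) (inst φ (var y) ∷ (Δ ─ i)) ch)) → Der C G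
  diaR : ∀ {G w u σ Δ ch σ' Δ' ch' φ} → get G w ≡ just (node σ Δ ch) →
         dia φ ∈ Δ → get G u ≡ just (node σ' Δ' ch') → Reach G (LDia C) w u →
         Der C (set G u (node σ' (φ ∷ Δ') ch')) → Der C G
  boxR : ∀ {G w σ Δ ch φ} → get G w ≡ just (node σ Δ ch) →
         (i : box φ ∈ Δ) →
         Der C (set G w (node σ (Δ ─ i) (node [] (φ ∷ []) [] ∷ ch))) → Der C G
  ref  : ∀ {G w σ Δ ch} (t : Term) → get G w ≡ just (node σ Δ ch) →
         Der C (set G w (node σ (neq ⌜ t ⌝ ⌜ t ⌝ ∷ Δ) ch)) → Der C G
  rep  : ∀ {G w σ Δ ch N} (t s : Term) (z : Var) → get G w ≡ just (node σ Δ ch) →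
         Negative N → neq ⌜ t ⌝ ⌜ s ⌝ ∈ Δ → substFm z t N ∈ Δ →
         Der C (set G w (node σ (substFm z s N ∷ Δ) ch)) → Der C G
  drep : ∀ {G w σ Δ ch} (t s : Term) → get G w ≡ just (node σ Δ ch) →
         t ∈ σ → neq ⌜ t ⌝ ⌜ s ⌝ ∈ Δ →
         Der C (set G w (node (s ∷ σ) Δ ch)) → Der C G
  rig  : ∀ {G w u σ Δ ch σ' Δ' ch'} (s t : Term) → get G w ≡ just (node σ Δ ch) →
         neq ⌜ s ⌝ ⌜ t ⌝ ∈ Δ → get G u ≡ just (node σ' Δ' ch') → w ≢ u →
         Der C (set G u (node σ' (neq ⌜ s ⌝ ⌜ t ⌝ ∷ Δ') ch')) → Der C G
  dp   : ∀ {G w u σ Δ ch σ' Δ' ch'} (t : Term) → get G w ≡ just (node σ Δ ch) →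
         t ∈ σ → get G u ≡ just (node σ' Δ' ch') → w ≢ u → DPCond C G w u →
         Der C (set G u (node (t ∷ σ') Δ' ch')) → Der C G
  d    : ∀ {G w σ Δ ch} → C cD → get G w ≡ just (node σ Δ ch) →
         Der C (set G w (node σ Δ (node [] [] [] ∷ ch))) → Der C G
  nd   : ∀ {G w σ Δ ch} (y : Var) → C cNE → get G w ≡ just (node σ Δ ch) →
         ¬ OccNS y G →
         Der C (set G w (node (var y ∷ σ) Δ ch)) → Der C G
  cd   : ∀ {G w σ Δ ch} (t : Term) → C cCD → get G w ≡ just (node σ Δ ch) →
         Der C (set G w (node (t ∷ σ) Δ ch)) → Der C G

-- height = number of nodes on a maximal branch
height : ∀ {C G} → Der C G → ℕ
height (ax _ _ _ _) = 1
height (or _ _ p) = suc (height p)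
height (and _ _ p q) = suc (height p ⊔ height q)
height (exR _ _ _ p) = suc (height p)
height (allR _ _ _ _ p) = suc (height p)
height (diaR _ _ _ _ p) = suc (height p)
height (boxR _ _ p) = suc (height p)
height (ref _ _ p) = suc (height p)
height (rep _ _ _ _ _ _ _ p) = suc (height p)
height (drep _ _ _ _ _ p) = suc (height p)
height (rig _ _ _ _ _ _ p) = suc (height p)
height (dp _ _ _ _ _ _ p) = suc (height p)
height (d _ _ p) = suc (height p)
height (nd _ _ _ _ p) = suc (height p)
height (cd _ _ _ p) = suc (height p)

-- Induction on the height bound, pushing (t/x) into the premises of the last rule.
-- Every rule commutes with (t/x): side conditions on the tree shape (component names,
-- propagation paths) are untouched, and literals, duals and instances commute with
-- substitution. The eigenvariable rules (∀) and (nd) are the exception, since t may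
-- contain the eigenvariable y: their premise is first renamed to a fresh y′, which is
-- itself a substitution of the same height, hence the induction on the height rather
-- than on the proof. Similarly, in (rep) the variable z of N(s/z) is renamed to a fresh
-- z′ so that the substituted formula is again of the form N′(s′/z′).
module Submission where

open import Defs
open import Data.Nat using (_≤_)
open import Data.Product using (Σ)

open import Data.Nat using (ℕ; zero; suc; _⊔_; _<_; z≤n; s≤s; _≟_)
open import Data.Nat.Properties
  using (≤-refl; ≤-trans; <⇒≱; <-irrefl; m≤m⊔n; m≤n⊔m; m⊔n≤o⇒m≤o; m⊔n≤o⇒n≤o; ⊔-lub)
open import Data.List using (List; []; _∷_; _++_; map)
open import Data.List.Properties using (map-id-local; map-++)
import Data.List.Relation.Unary.All as All
open import Data.List.Relation.Unary.Any using (here; there; _─_)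
open import Data.List.Membership.Propositional using (_∈_)
open import Data.List.Membership.Propositional.Properties using (∈-map⁺; ∈-map⁻)
open import Data.Vec using (Vec; []; _∷_)
import Data.Vec as Vec
open import Data.Vec.Properties using (map-∘; map-cong)
import Data.Vec.Relation.Unary.Any as VAny
open import Data.Maybe using (just)
open import Data.Product using (_,_; _×_; ∃)
import Data.Product as Prod
open import Data.Sum using (_⊎_; inj₁; inj₂)
import Data.Sum as Sum
open import Function using (_∘_)
open import Relation.Nullary using (¬_; yes; no; contradiction)
open import Relation.Binary.PropositionalEquality
  using (_≡_; _≢_; refl; sym; trans; cong; cong₂; subst)

private
  variable
    A B : Set

map-─ : (g : A → B) {a : A} {xs : List A} (i : a ∈ xs) →
        map g (xs ─ i) ≡ (map g xs ─ ∈-map⁺ g i)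
map-─ g (here refl) = refl
map-─ g {xs = x ∷ xs} (there i) = cong (g x ∷_) (map-─ g i)

∈-─⇒∈ : {a c : A} {xs : List A} (i : a ∈ xs) → c ∈ (xs ─ i) → c ∈ xs
∈-─⇒∈ (here refl) m = there m
∈-─⇒∈ (there i) (here refl) = here refl
∈-─⇒∈ (there i) (there m) = there (∈-─⇒∈ i m)

∈-map⁺-≡ : {g : A → B} {a : A} {c : B} {xs : List A} → g a ≡ c → a ∈ xs → c ∈ map g xs
∈-map⁺-≡ {g = g} refl = ∈-map⁺ g

map-id-∈ : (g : A → A) (xs : List A) → (∀ {a} → a ∈ xs → g a ≡ a) → map g xs ≡ xs
map-id-∈ g xs fixed = map-id-local (All.tabulate fixed)

map∘map-cong : ∀ {n} {g₁ g₂ h₁ h₂ : A → A} → (∀ a → g₁ (g₂ a) ≡ h₁ (h₂ a)) →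
               (ts : Vec A n) → Vec.map g₁ (Vec.map g₂ ts) ≡ Vec.map h₁ (Vec.map h₂ ts)
map∘map-cong commute ts = trans (sym (map-∘ _ _ ts)) (trans (map-cong commute ts) (map-∘ _ _ ts))

substTm-self : ∀ x t → substTm x t (fv x) ≡ ⌜ t ⌝
substTm-self x t with x ≟ x
... | yes _  = refl
... | no x≢x = contradiction refl x≢x

substTm-other : ∀ {x y} t → x ≢ y → substTm x t (fv y) ≡ fv y
substTm-other {x} {y} t x≢y with x ≟ y
... | yes x≡y = contradiction x≡y x≢y
... | no _    = refl

substTerm-self : ∀ x t → substTerm x t (var x) ≡ t
substTerm-self x t with x ≟ x
... | yes _  = refl
... | no x≢x = contradiction refl x≢x

⌜⌝-substTerm : ∀ x t s → substTm x t ⌜ s ⌝ ≡ ⌜ substTerm x t s ⌝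
⌜⌝-substTerm x t (var y) with x ≟ y
... | yes _ = refl
... | no _  = refl
⌜⌝-substTerm x t (con c) = refl

substFm-neq : ∀ x t s r →
  substFm x t (neq ⌜ s ⌝ ⌜ r ⌝) ≡ neq ⌜ substTerm x t s ⌝ ⌜ substTerm x t r ⌝
substFm-neq x t s r = cong₂ neq (⌜⌝-substTerm x t s) (⌜⌝-substTerm x t r)

openTm-⌜⌝ : ∀ k s t → openTm k s ⌜ t ⌝ ≡ ⌜ t ⌝
openTm-⌜⌝ k s (var y) = refl
openTm-⌜⌝ k s (con c) = refl

substTm-openTm : ∀ x t k s a →
  substTm x t (openTm k s a) ≡ openTm k (substTerm x t s) (substTm x t a)
substTm-openTm x t k s (fv y) with x ≟ y
... | yes _ = sym (openTm-⌜⌝ k _ t)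
... | no _  = refl
substTm-openTm x t k s (cn c) = refl
substTm-openTm x t k s (bv i) with k ≟ i
... | yes _ = ⌜⌝-substTerm x t s
... | no _  = refl

substFm-openAt : ∀ x t k s φ →
  substFm x t (openAt k s φ) ≡ openAt k (substTerm x t s) (substFm x t φ)
substFm-openAt x t k s (pos P ts) = cong (pos P) (map∘map-cong (substTm-openTm x t k s) ts)
substFm-openAt x t k s (neg P ts) = cong (neg P) (map∘map-cong (substTm-openTm x t k s) ts)
substFm-openAt x t k s (eq a c)  = cong₂ eq (substTm-openTm x t k s a) (substTm-openTm x t k s c)
substFm-openAt x t k s (neq a c) = cong₂ neq (substTm-openTm x t k s a) (substTm-openTm x t k s c)
substFm-openAt x t k s (φ ∨ ψ)   = cong₂ _∨_ (substFm-openAt x t k s φ) (substFm-openAt x t k s ψ)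
substFm-openAt x t k s (φ ∧ ψ)   = cong₂ _∧_ (substFm-openAt x t k s φ) (substFm-openAt x t k s ψ)
substFm-openAt x t k s (ex φ)    = cong ex (substFm-openAt x t (suc k) s φ)
substFm-openAt x t k s (all φ)   = cong all (substFm-openAt x t (suc k) s φ)
substFm-openAt x t k s (dia φ)   = cong dia (substFm-openAt x t k s φ)
substFm-openAt x t k s (box φ)   = cong box (substFm-openAt x t k s φ)

substFm-inst : ∀ x t φ s → substFm x t (inst φ s) ≡ inst (substFm x t φ) (substTerm x t s)
substFm-inst x t φ s = substFm-openAt x t 0 s φ

substFm-dual : ∀ x t φ → substFm x t (dual φ) ≡ dual (substFm x t φ)
substFm-dual x t (pos P ts) = refl
substFm-dual x t (neg P ts) = refl
substFm-dual x t (eq a c)   = refl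
substFm-dual x t (neq a c)  = refl
substFm-dual x t (φ ∨ ψ)    = cong₂ _∧_ (substFm-dual x t φ) (substFm-dual x t ψ)
substFm-dual x t (φ ∧ ψ)    = cong₂ _∨_ (substFm-dual x t φ) (substFm-dual x t ψ)
substFm-dual x t (ex φ)     = cong all (substFm-dual x t φ)
substFm-dual x t (all φ)    = cong ex (substFm-dual x t φ)
substFm-dual x t (dia φ)    = cong box (substFm-dual x t φ)
substFm-dual x t (box φ)    = cong dia (substFm-dual x t φ)

Literal-substFm : ∀ x t {φ} → Literal φ → Literal (substFm x t φ)
Literal-substFm x t (lpos P ts) = lpos P _
Literal-substFm x t (lneg P ts) = lneg P _
Literal-substFm x t (leq a c)   = leq _ _
Literal-substFm x t (lneq a c)  = lneq _ _

Negative-substFm : ∀ x t {φ} → Negative φ → Negative (substFm x t φ)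
Negative-substFm x t (nneg P ts) = nneg P _
Negative-substFm x t (nneq a c)  = nneq _ _

substTm-fresh : ∀ {y} s a → ¬ OccTm y a → substTm y s a ≡ a
substTm-fresh {y} s (fv z) y∉ = substTm-other {y} s (λ { refl → y∉ here })
substTm-fresh s (cn c) y∉ = refl
substTm-fresh s (bv i) y∉ = refl

substVec-fresh : ∀ {y n} s (ts : Vec Tm n) → ¬ VAny.Any (OccTm y) ts → Vec.map (substTm y s) ts ≡ ts
substVec-fresh s []       y∉ = refl
substVec-fresh s (a ∷ ts) y∉ =
  cong₂ _∷_ (substTm-fresh s a (y∉ ∘ VAny.here)) (substVec-fresh s ts (y∉ ∘ VAny.there))

substFm-fresh : ∀ {y} s φ → ¬ OccFm y φ → substFm y s φ ≡ φ
substFm-fresh s (pos P ts) y∉ = cong (pos P) (substVec-fresh s ts (y∉ ∘ opos))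
substFm-fresh s (neg P ts) y∉ = cong (neg P) (substVec-fresh s ts (y∉ ∘ oneg))
substFm-fresh s (eq a c)   y∉ =
  cong₂ eq (substTm-fresh s a (y∉ ∘ oeq₁)) (substTm-fresh s c (y∉ ∘ oeq₂))
substFm-fresh s (neq a c)  y∉ =
  cong₂ neq (substTm-fresh s a (y∉ ∘ oneq₁)) (substTm-fresh s c (y∉ ∘ oneq₂))
substFm-fresh s (φ ∨ ψ)    y∉ =
  cong₂ _∨_ (substFm-fresh s φ (y∉ ∘ oor₁)) (substFm-fresh s ψ (y∉ ∘ oor₂))
substFm-fresh s (φ ∧ ψ)    y∉ =
  cong₂ _∧_ (substFm-fresh s φ (y∉ ∘ oand₁)) (substFm-fresh s ψ (y∉ ∘ oand₂))
substFm-fresh s (ex φ)     y∉ = cong ex (substFm-fresh s φ (y∉ ∘ oex))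
substFm-fresh s (all φ)    y∉ = cong all (substFm-fresh s φ (y∉ ∘ oall))
substFm-fresh s (dia φ)    y∉ = cong dia (substFm-fresh s φ (y∉ ∘ odia))
substFm-fresh s (box φ)    y∉ = cong box (substFm-fresh s φ (y∉ ∘ obox))

substTerm-fresh : ∀ {y} s a → a ≢ var y → substTerm y s a ≡ a
substTerm-fresh {y} s (var z) z≢y with y ≟ z
... | yes refl = contradiction refl z≢y
... | no _     = refl
substTerm-fresh s (con c) _ = refl

map-substTerm-fresh : ∀ {y} s σ → ¬ var y ∈ σ → map (substTerm y s) σ ≡ σ
map-substTerm-fresh s σ y∉ = map-id-∈ _ σ (λ m → substTerm-fresh s _ (λ { refl → y∉ m }))

map-substFm-fresh : ∀ {y} s Γ → (∀ {φ} → φ ∈ Γ → ¬ OccFm y φ) →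
  map (substFm y s) Γ ≡ Γ
map-substFm-fresh s Γ y∉ = map-id-∈ _ Γ (λ m → substFm-fresh s _ (y∉ m))

substNS-fresh : ∀ {y} s G → ¬ OccNS y G → substNS y s G ≡ G
substNSs-fresh : ∀ {y} s ch → (∀ {H} → H ∈ ch → ¬ OccNS y H) → substNSs y s ch ≡ ch
substNS-fresh s (node σ Δ ch) y∉ =
  trans (cong (λ σ′ → node σ′ _ _) (map-substTerm-fresh s σ (y∉ ∘ osig)))
        (cong₂ (node σ) (map-substFm-fresh s Δ (λ m → y∉ ∘ ofm m))
                        (substNSs-fresh s ch (λ m → y∉ ∘ och m)))
substNSs-fresh s []       y∉ = refl
substNSs-fresh s (H ∷ hs) y∉ =
  cong₂ _∷_ (substNS-fresh s H (y∉ (here refl))) (substNSs-fresh s hs (y∉ ∘ there))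

substFm-inst-fresh : ∀ {y} s φ → ¬ OccFm y φ → substFm y s (inst φ (var y)) ≡ inst φ s
substFm-inst-fresh {y} s φ y∉ =
  trans (substFm-inst y s φ (var y)) (cong₂ inst (substFm-fresh s φ y∉) (substTerm-self y s))

substFm-inst-var : ∀ {x y} t φ → x ≢ y →
  substFm x t (inst φ (var y)) ≡ inst (substFm x t φ) (var y)
substFm-inst-var {x} {y} t φ x≢y =
  trans (substFm-inst x t φ (var y))
        (cong (inst _) (substTerm-fresh t (var y) (λ { refl → x≢y refl })))

OccTm-⌜⌝ : ∀ {y} t → OccTm y ⌜ t ⌝ → t ≡ var y
OccTm-⌜⌝ (var z) here = refl

OccTm-substTm⁻ : ∀ {y} x t a → OccTm y (substTm x t a) → t ≡ var y ⊎ OccTm y a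
OccTm-substTm⁻ x t (fv z) o with x ≟ z
... | yes _ = inj₁ (OccTm-⌜⌝ t o)
... | no _  = inj₂ o

OccVec-substVec⁻ : ∀ {y n} x t (ts : Vec Tm n) →
  VAny.Any (OccTm y) (Vec.map (substTm x t) ts) → t ≡ var y ⊎ VAny.Any (OccTm y) ts
OccVec-substVec⁻ x t (a ∷ ts) (VAny.here o)  = Sum.map₂ VAny.here (OccTm-substTm⁻ x t a o)
OccVec-substVec⁻ x t (a ∷ ts) (VAny.there o) = Sum.map₂ VAny.there (OccVec-substVec⁻ x t ts o)

OccFm-substFm⁻ : ∀ {y} x t φ → OccFm y (substFm x t φ) → t ≡ var y ⊎ OccFm y φ
OccFm-substFm⁻ x t (pos P ts) (opos o)  = Sum.map₂ opos (OccVec-substVec⁻ x t ts o)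
OccFm-substFm⁻ x t (neg P ts) (oneg o)  = Sum.map₂ oneg (OccVec-substVec⁻ x t ts o)
OccFm-substFm⁻ x t (eq a c)   (oeq₁ o)  = Sum.map₂ oeq₁ (OccTm-substTm⁻ x t a o)
OccFm-substFm⁻ x t (eq a c)   (oeq₂ o)  = Sum.map₂ oeq₂ (OccTm-substTm⁻ x t c o)
OccFm-substFm⁻ x t (neq a c)  (oneq₁ o) = Sum.map₂ oneq₁ (OccTm-substTm⁻ x t a o)
OccFm-substFm⁻ x t (neq a c)  (oneq₂ o) = Sum.map₂ oneq₂ (OccTm-substTm⁻ x t c o)
OccFm-substFm⁻ x t (φ ∨ ψ)    (oor₁ o)  = Sum.map₂ oor₁ (OccFm-substFm⁻ x t φ o)
OccFm-substFm⁻ x t (φ ∨ ψ)    (oor₂ o)  = Sum.map₂ oor₂ (OccFm-substFm⁻ x t ψ o)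
OccFm-substFm⁻ x t (φ ∧ ψ)    (oand₁ o) = Sum.map₂ oand₁ (OccFm-substFm⁻ x t φ o)
OccFm-substFm⁻ x t (φ ∧ ψ)    (oand₂ o) = Sum.map₂ oand₂ (OccFm-substFm⁻ x t ψ o)
OccFm-substFm⁻ x t (ex φ)     (oex o)   = Sum.map₂ oex (OccFm-substFm⁻ x t φ o)
OccFm-substFm⁻ x t (all φ)    (oall o)  = Sum.map₂ oall (OccFm-substFm⁻ x t φ o)
OccFm-substFm⁻ x t (dia φ)    (odia o)  = Sum.map₂ odia (OccFm-substFm⁻ x t φ o)
OccFm-substFm⁻ x t (box φ)    (obox o)  = Sum.map₂ obox (OccFm-substFm⁻ x t φ o)

substTerm⁻ : ∀ {y} x t a → substTerm x t a ≡ var y → t ≡ var y ⊎ a ≡ var y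
substTerm⁻ x t (var z) e with x ≟ z
... | yes _ = inj₁ e
... | no _  = inj₂ e

OccNS-substNS⁻ : ∀ {y} x t G → OccNS y (substNS x t G) → t ≡ var y ⊎ OccNS y G
OccNSs-substNSs⁻ : ∀ {y} x t ch {H} → H ∈ substNSs x t ch → OccNS y H →
  t ≡ var y ⊎ ∃ λ H′ → H′ ∈ ch × OccNS y H′
OccNS-substNS⁻ x t (node σ Δ ch) (osig m) with ∈-map⁻ (substTerm x t) m
... | a , a∈σ , e = Sum.map₂ (λ { refl → osig a∈σ }) (substTerm⁻ x t a (sym e))
OccNS-substNS⁻ x t (node σ Δ ch) (ofm m o) with ∈-map⁻ (substFm x t) m
... | φ , φ∈Δ , refl = Sum.map₂ (ofm φ∈Δ) (OccFm-substFm⁻ x t φ o)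
OccNS-substNS⁻ x t (node σ Δ ch) (och m o) =
  Sum.map₂ (λ (H′ , H′∈ch , o′) → och H′∈ch o′) (OccNSs-substNSs⁻ x t ch m o)
OccNSs-substNSs⁻ x t (K ∷ ks) (here refl) o =
  Sum.map₂ (λ o′ → K , here refl , o′) (OccNS-substNS⁻ x t K o)
OccNSs-substNSs⁻ x t (K ∷ ks) (there m) o =
  Sum.map₂ (Prod.map₂ (Prod.map₁ there)) (OccNSs-substNSs⁻ x t ks m o)

∉-substNS : ∀ {y} x t G → ¬ OccNS y G → t ≢ var y → ¬ OccNS y (substNS x t G)
∉-substNS x t G y∉G t≢y o = Sum.[ t≢y , y∉G ] (OccNS-substNS⁻ x t G o)

supTm : Tm → ℕ
supTm (fv y) = suc y
supTm (cn c) = 0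
supTm (bv i) = 0

supVec : ∀ {n} → Vec Tm n → ℕ
supVec []       = 0
supVec (a ∷ ts) = supTm a ⊔ supVec ts

supFm : Fm → ℕ
supFm (pos P ts) = supVec ts
supFm (neg P ts) = supVec ts
supFm (eq a c)   = supTm a ⊔ supTm c
supFm (neq a c)  = supTm a ⊔ supTm c
supFm (φ ∨ ψ)    = supFm φ ⊔ supFm ψ
supFm (φ ∧ ψ)    = supFm φ ⊔ supFm ψ
supFm (ex φ)     = supFm φ
supFm (all φ)    = supFm φ
supFm (dia φ)    = supFm φ
supFm (box φ)    = supFm φ

supTerm : Term → ℕ
supTerm (var y) = suc y
supTerm (con c) = 0

supList : (A → ℕ) → List A → ℕ
supList sup []       = 0
supList sup (a ∷ as) = sup a ⊔ supList sup as

supNS : NSeq → ℕ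
supNSs : List NSeq → ℕ
supNS (node σ Δ ch) = supList supTerm σ ⊔ (supList supFm Δ ⊔ supNSs ch)
supNSs []       = 0
supNSs (H ∷ hs) = supNS H ⊔ supNSs hs

≤-supList : ∀ {sup : A → ℕ} {a as} → a ∈ as → sup a ≤ supList sup as
≤-supList (here refl) = m≤m⊔n _ _
≤-supList (there m)   = ≤-trans (≤-supList m) (m≤n⊔m _ _)

≤-supNSs : ∀ {H ch} → H ∈ ch → supNS H ≤ supNSs ch
≤-supNSs (here refl) = m≤m⊔n _ _
≤-supNSs (there m)   = ≤-trans (≤-supNSs m) (m≤n⊔m _ _)

OccVec⇒<supVec : ∀ {y n} {ts : Vec Tm n} → VAny.Any (OccTm y) ts → y < supVec ts
OccVec⇒<supVec {y} {ts = _ ∷ ts} (VAny.here here) = m≤m⊔n (suc y) (supVec ts)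
OccVec⇒<supVec (VAny.there o)   = ≤-trans (OccVec⇒<supVec o) (m≤n⊔m _ _)

OccFm⇒<supFm : ∀ {y φ} → OccFm y φ → y < supFm φ
OccFm⇒<supFm (opos o)        = OccVec⇒<supVec o
OccFm⇒<supFm (oneg o)        = OccVec⇒<supVec o
OccFm⇒<supFm {φ = eq _ c} (oeq₁ here) = m≤m⊔n _ (supTm c)
OccFm⇒<supFm {φ = eq a _} (oeq₂ here) = m≤n⊔m (supTm a) _
OccFm⇒<supFm {φ = neq _ c} (oneq₁ here) = m≤m⊔n _ (supTm c)
OccFm⇒<supFm {φ = neq a _} (oneq₂ here) = m≤n⊔m (supTm a) _
OccFm⇒<supFm (oor₁ o)        = ≤-trans (OccFm⇒<supFm o) (m≤m⊔n _ _)
OccFm⇒<supFm (oor₂ o)        = ≤-trans (OccFm⇒<supFm o) (m≤n⊔m _ _)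
OccFm⇒<supFm (oand₁ o)       = ≤-trans (OccFm⇒<supFm o) (m≤m⊔n _ _)
OccFm⇒<supFm (oand₂ o)       = ≤-trans (OccFm⇒<supFm o) (m≤n⊔m _ _)
OccFm⇒<supFm (oex o)         = OccFm⇒<supFm o
OccFm⇒<supFm (oall o)        = OccFm⇒<supFm o
OccFm⇒<supFm (odia o)        = OccFm⇒<supFm o
OccFm⇒<supFm (obox o)        = OccFm⇒<supFm o

OccNS⇒<supNS : ∀ {y G} → OccNS y G → y < supNS G
OccNS⇒<supNS {G = node σ Δ ch} (osig m) =
  ≤-trans (≤-supList m) (m≤m⊔n _ (supList supFm Δ ⊔ supNSs ch))
OccNS⇒<supNS {G = node σ Δ ch} (ofm m o) =
  ≤-trans (OccFm⇒<supFm o)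
          (≤-trans (≤-supList m) (≤-trans (m≤m⊔n _ (supNSs ch)) (m≤n⊔m (supList supTerm σ) _)))
OccNS⇒<supNS {G = node σ Δ ch} (och m o) =
  ≤-trans (OccNS⇒<supNS o)
          (≤-trans (≤-supNSs m) (≤-trans (m≤n⊔m (supList supFm Δ) _) (m≤n⊔m (supList supTerm σ) _)))

freshVar : ℕ → Var → Term → Var
freshVar n x t = n ⊔ (suc x ⊔ supTerm t)

freshVar-∉NS : ∀ G x t → ¬ OccNS (freshVar (supNS G) x t) G
freshVar-∉NS G x t o = <⇒≱ (OccNS⇒<supNS o) (m≤m⊔n _ _)

freshVar-∉Fm : ∀ φ x t → ¬ OccFm (freshVar (supFm φ) x t) φ
freshVar-∉Fm φ x t o = <⇒≱ (OccFm⇒<supFm o) (m≤m⊔n _ _)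

freshVar-≢ : ∀ n x t → x ≢ freshVar n x t
freshVar-≢ n x t x≡y = <-irrefl x≡y (≤-trans (m≤m⊔n (suc x) (supTerm t)) (m≤n⊔m n _))

freshVar-∉ : ∀ n x t → t ≢ var (freshVar n x t)
freshVar-∉ n x t t≡y =
  <-irrefl refl (subst (λ s → supTerm s ≤ freshVar n x t) t≡y
                       (≤-trans (m≤n⊔m (suc x) (supTerm t)) (m≤n⊔m n _)))

substTm-comm : ∀ {x z} t r a → x ≢ z → t ≢ var z →
  substTm z (substTerm x t r) (substTm x t a) ≡ substTm x t (substTm z r a)
substTm-comm {x} {z} t r (fv y) x≢z t≢z with x ≟ y | z ≟ y
... | yes refl | yes refl = contradiction refl x≢z
... | yes refl | no _     =
  trans (substTm-fresh {z} _ ⌜ t ⌝ (t≢z ∘ OccTm-⌜⌝ t)) (sym (substTm-self x t))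
... | no _     | yes refl = trans (substTm-self z _) (sym (⌜⌝-substTerm x t r))
... | no x≢y   | no z≢y   = trans (substTm-other {z} _ z≢y) (sym (substTm-other t x≢y))
substTm-comm t r (cn c) _ _ = refl
substTm-comm t r (bv i) _ _ = refl

substTm-rename : ∀ {z z′} r a → ¬ OccTm z′ a →
  substTm z′ r (substTm z (var z′) a) ≡ substTm z r a
substTm-rename {z} {z′} r (fv y) z′∉ with z ≟ y
... | yes _ = substTm-self z′ r
... | no _  = substTm-other {z′} r (λ { refl → z′∉ here })
substTm-rename r (cn c) _ = refl
substTm-rename r (bv i) _ = refl

substVec-rename : ∀ {z z′ n} r (ts : Vec Tm n) → ¬ VAny.Any (OccTm z′) ts →
  Vec.map (substTm z′ r) (Vec.map (substTm z (var z′)) ts) ≡ Vec.map (substTm z r) ts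
substVec-rename r []       _   = refl
substVec-rename r (a ∷ ts) z′∉ =
  cong₂ _∷_ (substTm-rename r a (z′∉ ∘ VAny.here)) (substVec-rename r ts (z′∉ ∘ VAny.there))

substNeg-comm : ∀ {x z N} t r → Negative N → x ≢ z → t ≢ var z →
  substFm z (substTerm x t r) (substFm x t N) ≡ substFm x t (substFm z r N)
substNeg-comm t r (nneg P ts) x≢z t≢z =
  cong (neg P) (map∘map-cong (λ a → substTm-comm t r a x≢z t≢z) ts)
substNeg-comm t r (nneq a c)  x≢z t≢z =
  cong₂ neq (substTm-comm t r a x≢z t≢z) (substTm-comm t r c x≢z t≢z)

substNeg-rename : ∀ {z z′ N} r → Negative N → ¬ OccFm z′ N →
  substFm z′ r (substFm z (var z′) N) ≡ substFm z r N
substNeg-rename r (nneg P ts) z′∉ = cong (neg P) (substVec-rename r ts (z′∉ ∘ oneg))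
substNeg-rename r (nneq a c)  z′∉ =
  cong₂ neq (substTm-rename r a (z′∉ ∘ oneq₁)) (substTm-rename r c (z′∉ ∘ oneq₂))

get-substNS : ∀ x t G w {H} → get G w ≡ just H → get (substNS x t G) w ≡ just (substNS x t H)
getCh-substNSs : ∀ x t ch i p {H} → getCh ch i p ≡ just H →
  getCh (substNSs x t ch) i p ≡ just (substNS x t H)
get-substNS x t G [] refl = refl
get-substNS x t (node σ Δ ch) (i ∷ p) e = getCh-substNSs x t ch i p e
getCh-substNSs x t []       i       p ()
getCh-substNSs x t (K ∷ ks) zero    p e = get-substNS x t K p e
getCh-substNSs x t (K ∷ ks) (suc i) p e = getCh-substNSs x t ks i p e

substNS-set : ∀ x t G w K → substNS x t (set G w K) ≡ set (substNS x t G) w (substNS x t K)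
substNSs-setCh : ∀ x t ch i p K →
  substNSs x t (setCh ch i p K) ≡ setCh (substNSs x t ch) i p (substNS x t K)
substNS-set x t G [] K = refl
substNS-set x t (node σ Δ ch) (i ∷ p) K = cong (node _ _) (substNSs-setCh x t ch i p K)
substNSs-setCh x t []       i       p K = refl
substNSs-setCh x t (H ∷ hs) zero    p K = cong (_∷ substNSs x t hs) (substNS-set x t H p K)
substNSs-setCh x t (H ∷ hs) (suc i) p K = cong (substNS x t H ∷_) (substNSs-setCh x t hs i p K)

get-OccNS : ∀ {y} G w {H} → get G w ≡ just H → OccNS y H → OccNS y G
getCh-OccNS : ∀ {y} ch i p {H} → getCh ch i p ≡ just H → OccNS y H →
  ∃ λ K → K ∈ ch × OccNS y K
get-OccNS G [] refl o = o
get-OccNS (node σ Δ ch) (i ∷ p) e o = let K , K∈ch , o′ = getCh-OccNS ch i p e o in och K∈ch o′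
getCh-OccNS []       i       p () o
getCh-OccNS (K ∷ ks) zero    p e o = K , here refl , get-OccNS K p e o
getCh-OccNS (K ∷ ks) (suc i) p e o = Prod.map₂ (Prod.map₁ there) (getCh-OccNS ks i p e o)

Valid-substNS : ∀ x t G u → Valid G u → Valid (substNS x t G) u
Valid-substNS x t G u (H , e) = substNS x t H , get-substNS x t G u e

module _ {G G′ : NSeq} (valid : ∀ u → Valid G u → Valid G′ u) where

  Edge-mono : ∀ c {w u} → Edge G c w u → Edge G′ c w u
  Edge-mono f {u = u} (i , e , v) = i , e , valid u v
  Edge-mono b {w = w} (i , e , v) = i , e , valid w v

  Path-mono : ∀ s {w u} → Path G s w u → Path G′ s w u
  Path-mono []      e              = e
  Path-mono (c ∷ s) (v , edge , p) = v , Edge-mono c edge , Path-mono s p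

  Reach-mono : ∀ {L w u} → Reach G L w u → Reach G′ L w u
  Reach-mono (s , s∈L , p) = s , s∈L , Path-mono s p

  DPCond-mono : ∀ {C w u} → DPCond C G w u → DPCond C G′ w u
  DPCond-mono = Sum.map reach (Sum.map reach reach)
    where
    reach : ∀ {P Q : Set} {L w u} → P × Q × Reach G L w u → P × Q × Reach G′ L w u
    reach = Prod.map₂ (Prod.map₂ Reach-mono)

substNS-set-node : ∀ x t G w {σ Γ Γ′ ch} → map (substFm x t) Γ ≡ Γ′ →
  substNS x t (set G w (node σ Γ ch))
    ≡ set (substNS x t G) w (node (map (substTerm x t) σ) Γ′ (substNSs x t ch))
substNS-set-node x t G w refl = substNS-set x t G w _

substNS-rename-eigen : ∀ {y σ Δ ch Γ Γ′} v G w → ¬ OccNS y G → get G w ≡ just (node σ Δ ch) →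
  map (substFm y v) Γ ≡ Γ′ →
  substNS y v (set G w (node (var y ∷ σ) Γ ch)) ≡ set G w (node (v ∷ σ) Γ′ ch)
substNS-rename-eigen {y} {σ} {Δ} {ch} {Γ′ = Γ′} v G w y∉G e eΓ =
  trans (substNS-set-node y v G w eΓ)
        (cong₂ (λ G′ K → set G′ w K) (substNS-fresh v G y∉G)
               (cong₂ (λ σ′ ch′ → node σ′ Γ′ ch′)
                      (cong₂ _∷_ (substTerm-self y v) (map-substTerm-fresh v σ (y∉H ∘ osig)))
                      (substNSs-fresh v ch (λ m → y∉H ∘ och m))))
  where
  y∉H : ¬ OccNS y (node σ Δ ch)
  y∉H = y∉G ∘ get-OccNS G w e

substNS-set-eigen : ∀ x t G w {y σ Γ Γ′ ch} → x ≢ y → map (substFm x t) Γ ≡ Γ′ →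
  substNS x t (set G w (node (var y ∷ σ) Γ ch))
    ≡ set (substNS x t G) w (node (var y ∷ map (substTerm x t) σ) Γ′ (substNSs x t ch))
substNS-set-eigen x t G w x≢y eΓ =
  trans (substNS-set-node x t G w eΓ)
        (cong (λ a → set _ w (node (a ∷ _) _ _)) (substTerm-fresh t _ (λ { refl → x≢y refl })))

substNS-set-─ : ∀ x t G w {σ Δ ch φ} Γ (i : φ ∈ Δ) →
  substNS x t (set G w (node σ (Γ ++ (Δ ─ i)) ch))
    ≡ set (substNS x t G) w
          (node (map (substTerm x t) σ)
                (map (substFm x t) Γ ++ (map (substFm x t) Δ ─ ∈-map⁺ _ i))
                (substNSs x t ch))
substNS-set-─ x t G w Γ i =
  substNS-set-node x t G w (trans (map-++ _ Γ _) (cong (map _ Γ ++_) (map-─ _ i)))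

Der≤ : CondSet → NSeq → ℕ → Set
Der≤ C G n = Σ (Der C G) λ π → height π ≤ n

module _ {C : CondSet} where

  substDer≤ : ∀ {n} x t {G} → Der≤ C G n → Der≤ C (substNS x t G) n

  substPremise : ∀ {n} x t {P Q} → substNS x t P ≡ Q → Der≤ C P n → Der≤ C Q n
  substPremise x t refl = substDer≤ x t

  substEigenPremise : ∀ {n G w σ Δ ch y Γ Γ′ Γ″} x t y′ → get G w ≡ just (node σ Δ ch) →
    ¬ OccNS y G → x ≢ y′ → map (substFm y (var y′)) Γ ≡ Γ′ → map (substFm x t) Γ′ ≡ Γ″ →
    Der≤ C (set G w (node (var y ∷ σ) Γ ch)) n →
    Der≤ C (set (substNS x t G) w (node (var y′ ∷ map (substTerm x t) σ) Γ″ (substNSs x t ch))) n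
  substEigenPremise {G = G} {w} {y = y} x t y′ e y∉G x≢y′ renamed substituted =
    substPremise x t (substNS-set-eigen x t G w x≢y′ substituted)
    ∘ substPremise y (var y′) (substNS-rename-eigen (var y′) G w y∉G e renamed)

  substDer≤ x t (ax {G = G} {w = w} {L = L} e l L∈ L̄∈ , s≤s _) =
    ax {w = w} (get-substNS x t G w e) (Literal-substFm x t l)
       (∈-map⁺ (substFm x t) L∈) (∈-map⁺-≡ (substFm-dual x t L) L̄∈) , s≤s z≤n
  substDer≤ x t (or {G = G} {w = w} {φ = φ} {ψ = ψ} e i p , s≤s h) =
    Prod.map (or {w = w} (get-substNS x t G w e) (∈-map⁺ (substFm x t) i)) s≤s
      (substPremise x t (substNS-set-─ x t G w (φ ∷ ψ ∷ []) i) (p , h))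
  substDer≤ x t (and {G = G} {w = w} {φ = φ} {ψ = ψ} e i p q , s≤s h) =
    Prod.zip (and {w = w} (get-substNS x t G w e) (∈-map⁺ (substFm x t) i))
             (λ h₁ h₂ → s≤s (⊔-lub h₁ h₂))
      (substPremise x t (substNS-set-─ x t G w (φ ∷ []) i) (p , m⊔n≤o⇒m≤o _ _ h))
      (substPremise x t (substNS-set-─ x t G w (ψ ∷ []) i) (q , m⊔n≤o⇒n≤o _ _ h))
  substDer≤ x t (exR {G = G} {w = w} {ψ = ψ} {t = s} e s∈σ ψ∈ p , s≤s h) =
    Prod.map (exR {w = w} (get-substNS x t G w e) (∈-map⁺ (substTerm x t) s∈σ)
                  (∈-map⁺ (substFm x t) ψ∈)) s≤s
      (substPremise x t (substNS-set-node x t G w (cong (_∷ _) (substFm-inst x t ψ s))) (p , h))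
  substDer≤ x t (allR {G = G} {w = w} {σ = σ} {Δ = Δ} {ch = ch} {φ = φ} y e i y∉G p , s≤s h) =
    Prod.map (allR {w = w} y′ (get-substNS x t G w e) (∈-map⁺ (substFm x t) i)
                   (∉-substNS x t G (freshVar-∉NS G x t) (freshVar-∉ (supNS G) x t))) s≤s
      (substEigenPremise x t y′ e y∉G (freshVar-≢ (supNS G) x t)
        (cong₂ _∷_ (substFm-inst-fresh _ φ (y∉H ∘ ofm i ∘ oall))
                   (map-substFm-fresh _ (Δ ─ i) (λ m → y∉H ∘ ofm (∈-─⇒∈ i m))))
        (cong₂ _∷_ (substFm-inst-var t φ (freshVar-≢ (supNS G) x t)) (map-─ _ i))
        (p , h))
    where
    y′ : Var
    y′ = freshVar (supNS G) x t
    y∉H : ¬ OccNS y (node σ Δ ch)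
    y∉H = y∉G ∘ get-OccNS G w e
  substDer≤ x t (diaR {G = G} {w = w} {u = u} e ◇∈ e′ reach p , s≤s h) =
    Prod.map (diaR {w = w} {u = u} (get-substNS x t G w e) (∈-map⁺ (substFm x t) ◇∈)
                   (get-substNS x t G u e′) (Reach-mono (Valid-substNS x t G) reach)) s≤s
      (substPremise x t (substNS-set x t G u _) (p , h))
  substDer≤ x t (boxR {G = G} {w = w} e i p , s≤s h) =
    Prod.map (boxR {w = w} (get-substNS x t G w e) (∈-map⁺ (substFm x t) i)) s≤s
      (substPremise x t (substNS-set-─ x t G w [] i) (p , h))
  substDer≤ x t (ref {G = G} {w = w} {Δ = Δ} s e p , s≤s h) =
    Prod.map (ref {w = w} (substTerm x t s) (get-substNS x t G w e)) s≤s
      (substPremise x t (substNS-set-node x t G w (cong (_∷ map (substFm x t) Δ) (substFm-neq x t s s)))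
                    (p , h))
  substDer≤ x t (rep {G = G} {w = w} {N = N} s r z e negN ≠∈ Ns∈ p , s≤s h) =
    Prod.map (rep {w = w} {N = N′} (substTerm x t s) (substTerm x t r) z′ (get-substNS x t G w e)
                  (Negative-substFm x t (Negative-substFm z (var z′) negN))
                  (∈-map⁺-≡ (substFm-neq x t s r) ≠∈) (∈-map⁺-≡ (sym (renamed s)) Ns∈)) s≤s
      (substPremise x t (substNS-set-node x t G w (cong (_∷ _) (sym (renamed r)))) (p , h))
    where
    z′ : Var
    z′ = freshVar (supFm N) x t
    N′ : Fm
    N′ = substFm x t (substFm z (var z′) N)
    renamed : ∀ q → substFm z′ (substTerm x t q) N′ ≡ substFm x t (substFm z q N)
    renamed q =
      trans (substNeg-comm t q (Negative-substFm z (var z′) negN) (freshVar-≢ (supFm N) x t)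
                           (freshVar-∉ (supFm N) x t))
            (cong (substFm x t) (substNeg-rename q negN (freshVar-∉Fm N x t)))
  substDer≤ x t (drep {G = G} {w = w} s r e s∈σ ≠∈ p , s≤s h) =
    Prod.map (drep {w = w} (substTerm x t s) (substTerm x t r) (get-substNS x t G w e)
                   (∈-map⁺ (substTerm x t) s∈σ) (∈-map⁺-≡ (substFm-neq x t s r) ≠∈)) s≤s
      (substPremise x t (substNS-set x t G w _) (p , h))
  substDer≤ x t (rig {G = G} {w = w} {u = u} {Δ' = Δ′} s r e ≠∈ e′ w≢u p , s≤s h) =
    Prod.map (rig {w = w} {u = u} (substTerm x t s) (substTerm x t r) (get-substNS x t G w e)
                  (∈-map⁺-≡ (substFm-neq x t s r) ≠∈) (get-substNS x t G u e′) w≢u) s≤s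
      (substPremise x t (substNS-set-node x t G u (cong (_∷ map (substFm x t) Δ′) (substFm-neq x t s r)))
                    (p , h))
  substDer≤ x t (dp {G = G} {w = w} {u = u} s e s∈σ e′ w≢u cond p , s≤s h) =
    Prod.map (dp {w = w} {u = u} (substTerm x t s) (get-substNS x t G w e) (∈-map⁺ (substTerm x t) s∈σ)
                 (get-substNS x t G u e′) w≢u (DPCond-mono (Valid-substNS x t G) cond)) s≤s
      (substPremise x t (substNS-set x t G u _) (p , h))
  substDer≤ x t (d {G = G} {w = w} c e p , s≤s h) =
    Prod.map (d {w = w} c (get-substNS x t G w e)) s≤s (substPremise x t (substNS-set x t G w _) (p , h))
  substDer≤ x t (nd {G = G} {w = w} {Δ = Δ} y c e y∉G p , s≤s h) =
    Prod.map (nd {w = w} (freshVar (supNS G) x t) c (get-substNS x t G w e)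
                 (∉-substNS x t G (freshVar-∉NS G x t) (freshVar-∉ (supNS G) x t))) s≤s
      (substEigenPremise x t _ e y∉G (freshVar-≢ (supNS G) x t)
        (map-substFm-fresh _ Δ (λ m → y∉G ∘ get-OccNS G w e ∘ ofm m)) refl (p , h))
  substDer≤ x t (cd {G = G} {w = w} s c e p , s≤s h) =
    Prod.map (cd {w = w} (substTerm x t s) c (get-substNS x t G w e)) s≤s
      (substPremise x t (substNS-set x t G w _) (p , h))

mainTheorem6 : (C : CondSet) → Closed C → (x : Var) (t : Term) (G : NSeq) →
    (π : Der C G) → Σ (Der C (substNS x t G)) (λ π′ → height π′ ≤ height π)
mainTheorem6 C _ x t G π = substDer≤ x t (π , ≤-refl)
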